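{- Let $n,a,b$ be positive integers and $g=a+b$. Among the double brooms $B(n,a',b')$ with $a'+b'=g$, the Wiener index is maximum when $a=b=g/2$ if $g$ is even, and when $a=(g-1)/2$, $b=(g+1)/2$ if $g$ is odd.
   Context: The Wiener index of a connected graph $G$ is $W(G)=\sum_{\{u,v\}\subseteq V(G)} d(u,v)$. A leaf is a vertex of degree one; a broom vertex is a vertex adjacent to a leaf. A double broom $B(n,a,b)$ is a tree on $n$ vertices with exactly two broom vertices $x$ and $y$, where $\deg(x)=a+1$ and $\deg(y)=b+1$. -}

module Defs where

open import Data.Nat using (ℕ; zero; suc; _+_; _≤_; _<_)
open import Data.Bool using (Bool; true; false; _∧_; _∨_; if_then_else_; T)
open import Data.Fin using (Fin; toℕ)
open import Data.Fin.Properties using (_≟_)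
import Data.Fin as F
open import Data.List using (List; []; _∷_; length; filter; map; concatMap; allFin)
open import Data.Bool.ListAction using (any)
open import Data.Nat.ListAction using (sum)
open import Data.List.Relation.Unary.Unique.Propositional using (Unique)
open import Data.Product using (Σ; ∃; _×_; _,_)
open import Data.Sum using (_⊎_)
open import Data.Unit using (⊤)
open import Relation.Nullary using (¬_)
open import Relation.Nullary.Decidable using (⌊_⌋)
open import Relation.Binary.PropositionalEquality using (_≡_)

record SimpleGraph (n : ℕ) : Set where
  field
    adj    : Fin n → Fin n → Bool
    sym    : ∀ u v → adj u v ≡ adj v u
    irrefl : ∀ v → adj v v ≡ false
open SimpleGraph public

module _ {n : ℕ} (G : SimpleGraph n) where

  reach : ℕ → Fin n → Fin n → Bool
  reach zero    u v = ⌊ u ≟ v ⌋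
  reach (suc k) u v = reach k u v ∨ any (λ w → adj G u w ∧ reach k w v) (allFin n)

  searchDist : ℕ → ℕ → Fin n → Fin n → ℕ
  searchDist zero    j u v = j
  searchDist (suc f) j u v = if reach j u v then j else searchDist f (suc j) u v

  -- A shortest
  -- walk has length < n, so searching k = 0 … n-1 suffices; for a
  -- disconnected pair the value n is returned (irrelevant for trees).
  dist : Fin n → Fin n → ℕ
  dist u v = searchDist n 0 u v

  wiener : ℕ
  wiener = sum (concatMap (λ u → map (λ v → dist u v)
                                     (filter (λ v → u F.<? v) (allFin n)))
                          (allFin n))

  Connected : Set
  Connected = ∀ u v → T (reach n u v)

  IsWalk : List (Fin n) → Set
  IsWalk []           = ⊤
  IsWalk (x ∷ [])     = ⊤
  IsWalk (x ∷ y ∷ xs) = T (adj G x y) × IsWalk (y ∷ xs)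

  lastOr : Fin n → List (Fin n) → Fin n
  lastOr d []       = d
  lastOr d (x ∷ xs) = lastOr x xs

  IsCycle : Fin n → List (Fin n) → Set
  IsCycle v₀ vs = Unique (v₀ ∷ vs) × IsWalk (v₀ ∷ vs) × 2 ≤ length vs
                  × T (adj G (lastOr v₀ vs) v₀)

  Acyclic : Set
  Acyclic = ∀ v₀ vs → ¬ IsCycle v₀ vs

  IsTree : Set
  IsTree = Connected × Acyclic

  degree : Fin n → ℕ
  degree v = sum (map (λ w → if adj G v w then 1 else 0) (allFin n))

  IsLeaf : Fin n → Set
  IsLeaf v = degree v ≡ 1

  IsBroomVertex : Fin n → Set
  IsBroomVertex v = Σ (Fin n) λ w → T (adj G v w) × IsLeaf w

  IsDoubleBroom : ℕ → ℕ → Set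
  IsDoubleBroom a b =
    IsTree ×
    Σ (Fin n) λ x → Σ (Fin n) λ y →
      ¬ x ≡ y × IsBroomVertex x × IsBroomVertex y ×
      (∀ z → IsBroomVertex z → z ≡ x ⊎ z ≡ y) ×
      degree x ≡ suc a × degree y ≡ suc b

module Submission where

-- In a double broom with broom vertices x and y at distance D, every vertex lies on the x–y
-- geodesic (the spine, D + 1 vertices) or is one of the a leaves at x or the b leaves at y, so
-- n = D + 1 + a + b. Summing, for each vertex, its distances to all others (|i − j| along the spine,
-- d(x,u) + 1 or d(u,y) + 1 from a spine vertex u to a leaf, and for a leaf one more than from its
-- neighbour) gives 2 W + 2 g = F(n, g) + 2 D a b with g = a + b and D = n − 1 − g. For fixed n and g
-- the Wiener index therefore grows with a b, which is largest for the split ⌊g/2⌋, ⌈g/2⌉.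

open import Defs hiding (sym)
open import Defs using () renaming (sym to adj-sym)
open import Data.Nat using (ℕ; zero; suc; _+_; _*_; _∸_; _≤_; _<_; z≤n; s≤s; ∣_-_∣; _/_; _%_)
open import Data.Nat.Properties hiding (_≟_)
open import Data.Nat.Properties using () renaming (_≟_ to _≟ℕ_)
open import Data.Nat.DivMod using (m≡m%n+[m/n]*n; m%n<n; m/n*n≤m; m/n≤m)
open import Data.Nat.ListAction using (sum)
open import Data.Nat.ListAction.Properties using (sum-++)
open import Data.Nat.Tactic.RingSolver using (solve-∀)
open import Algebra.Properties.CommutativeSemigroup +-commutativeSemigroup using () renaming (interchange to +-interchange)
open import Data.Bool using (Bool; true; false; _∧_; not; if_then_else_)
open import Data.Bool.Properties using (T-≡)
open import Data.Fin as Fin using (Fin)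
open import Data.Fin.Properties using (_≟_)
import Data.Fin.Properties as Finₚ
open import Data.List using (List; []; _∷_; map; filter; concatMap; allFin; _∷ʳ_; concat; length)
open import Data.List.Properties using (map-tabulate)
open import Data.List.Relation.Unary.All as All using (All; []; _∷_)
open import Data.List.Relation.Unary.All.Properties using (∷ʳ⁺)
open import Data.List.Relation.Unary.Any using (here; there; satisfied)
open import Data.List.Membership.Propositional using (_∈_)
open import Data.List.Membership.Propositional.Properties using (∈-allFin)
open import Data.List.Relation.Unary.Any.Properties using (any⁺; any⁻; tabulate⁺)
open import Data.List.Relation.Unary.AllPairs using ([]; _∷_)
open import Data.List.Relation.Unary.Unique.Propositional using (Unique)
open import Data.Product using (Σ; _×_; _,_; proj₁; proj₂)
open import Data.Sum using (_⊎_; inj₁; inj₂)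
open import Data.Empty using (⊥; ⊥-elim)
open import Data.Unit using (tt)
open import Function using (_∘_; id)
open import Function.Bundles using (Equivalence)
open import Level using (0ℓ)
open import Relation.Nullary using (¬_; Dec; yes; no; does)
open import Relation.Nullary.Decidable using (⌊_⌋; toWitness; fromWitness)
open import Relation.Unary using (Pred; Decidable)
open import Relation.Binary.Definitions using (tri<; tri≈; tri>)
open import Relation.Binary.PropositionalEquality

open Equivalence using (to; from)

zero-or-suc : ∀ m → m ≡ 0 ⊎ Σ ℕ λ k → m ≡ suc k
zero-or-suc zero    = inj₁ refl
zero-or-suc (suc k) = inj₂ (k , refl)

∧-true⁻ : ∀ {p q} → p ∧ q ≡ true → p ≡ true × q ≡ true
∧-true⁻ {true} {true} _ = refl , refl

indicator : Bool → ℕ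
indicator b = if b then 1 else 0

sumOver : ∀ {A : Set} → List A → (A → ℕ) → ℕ
sumOver xs f = sum (map f xs)

module _ {A : Set} where

  sumOver-cong : ∀ (xs : List A) {f g : A → ℕ} → (∀ v → f v ≡ g v) → sumOver xs f ≡ sumOver xs g
  sumOver-cong []       f≗g = refl
  sumOver-cong (x ∷ xs) f≗g = cong₂ _+_ (f≗g x) (sumOver-cong xs f≗g)

  sumOver-+ : ∀ (xs : List A) (f g : A → ℕ) →
    sumOver xs (λ v → f v + g v) ≡ sumOver xs f + sumOver xs g
  sumOver-+ []       f g = refl
  sumOver-+ (x ∷ xs) f g = begin
      (f x + g x) + sumOver xs (λ v → f v + g v)     ≡⟨ cong (f x + g x +_) (sumOver-+ xs f g) ⟩
      (f x + g x) + (sumOver xs f + sumOver xs g)    ≡⟨ +-interchange (f x) (g x) _ _ ⟩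
      (f x + sumOver xs f) + (g x + sumOver xs g)    ∎
    where open ≡-Reasoning

  sumOver-*ˡ : ∀ (xs : List A) (c : ℕ) (f : A → ℕ) → sumOver xs (λ v → c * f v) ≡ c * sumOver xs f
  sumOver-*ˡ []       c f = sym (*-zeroʳ c)
  sumOver-*ˡ (x ∷ xs) c f =
    trans (cong (c * f x +_) (sumOver-*ˡ xs c f)) (sym (*-distribˡ-+ c (f x) (sumOver xs f)))

  sumOver-zero : ∀ (xs : List A) → sumOver xs (λ _ → 0) ≡ 0
  sumOver-zero []       = refl
  sumOver-zero (x ∷ xs) = sumOver-zero xs

  sumOver-positive : ∀ (xs : List A) (f : A → ℕ) → 1 ≤ sumOver xs f → Σ A λ v → 1 ≤ f v
  sumOver-positive (x ∷ xs) f pos with f x in eq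
  ... | zero  = sumOver-positive xs f pos
  ... | suc _ = x , subst (1 ≤_) (sym eq) (s≤s z≤n)

  sumOver-≥-member : ∀ {xs : List A} {w} (f : A → ℕ) → w ∈ xs → f w ≤ sumOver xs f
  sumOver-≥-member f (here refl) = m≤m+n _ _
  sumOver-≥-member {x ∷ _} f (there w∈xs) = ≤-trans (sumOver-≥-member f w∈xs) (m≤n+m _ (f x))

  sum-map-filter : ∀ (xs : List A) {P : Pred A 0ℓ} (P? : Decidable P) (g : A → ℕ) →
    sum (map g (filter P? xs)) ≡ sumOver xs (λ v → indicator (does (P? v)) * g v)
  sum-map-filter []       P? g = refl
  sum-map-filter (x ∷ xs) P? g with does (P? x)
  ... | true  = cong₂ _+_ (sym (+-identityʳ (g x))) (sum-map-filter xs P? g)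
  ... | false = sum-map-filter xs P? g

  sum-concatMap : (xs : List A) (f : A → List ℕ) → sum (concatMap f xs) ≡ sumOver xs (sum ∘ f)
  sum-concatMap []       f = refl
  sum-concatMap (x ∷ xs) f =
    trans (sum-++ (f x) (concat (map f xs))) (cong (sum (f x) +_) (sum-concatMap xs f))

sumOver-comm : ∀ {A B : Set} (xs : List A) (ys : List B) (F : A → B → ℕ) →
  sumOver xs (λ u → sumOver ys (F u)) ≡ sumOver ys (λ v → sumOver xs (λ u → F u v))
sumOver-comm []       ys F = sym (sumOver-zero ys)
sumOver-comm (x ∷ xs) ys F = trans (cong (sumOver ys (F x) +_) (sumOver-comm xs ys F))
  (sym (sumOver-+ ys (F x) (λ v → sumOver xs (λ u → F u v))))

∑Fin : ∀ {n} → (Fin n → ℕ) → ℕ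
∑Fin {n} = sumOver (allFin n)

∑Fin-suc : ∀ {n} (f : Fin (suc n) → ℕ) → ∑Fin f ≡ f Fin.zero + ∑Fin (f ∘ Fin.suc)
∑Fin-suc {n} f = cong (λ xs → f Fin.zero + sum xs)
  (trans (map-tabulate Fin.suc f) (sym (map-tabulate id (f ∘ Fin.suc))))

∑Fin-const-1 : ∀ n → ∑Fin {n} (λ _ → 1) ≡ n
∑Fin-const-1 zero    = refl
∑Fin-const-1 (suc n) = trans (∑Fin-suc {n} (λ _ → 1)) (cong suc (∑Fin-const-1 n))

∑Fin-point : ∀ {n} (w : Fin n) → ∑Fin (λ v → indicator ⌊ v ≟ w ⌋) ≡ 1
∑Fin-point {suc n} Fin.zero =
  trans (∑Fin-suc {n} (λ v → indicator ⌊ v ≟ Fin.zero ⌋)) (cong suc (sumOver-zero (allFin n)))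
∑Fin-point {suc n} (Fin.suc w) =
  trans (∑Fin-suc {n} (λ v → indicator ⌊ v ≟ Fin.suc w ⌋))
        (trans (sumOver-cong (allFin n) (cong indicator ∘ suc≟suc)) (∑Fin-point w))
  where
  suc≟suc : ∀ v → ⌊ Fin.suc v ≟ Fin.suc w ⌋ ≡ ⌊ v ≟ w ⌋
  suc≟suc v with v ≟ w
  ... | yes _ = refl
  ... | no  _ = refl

∑Fin-unique : ∀ {n} (P : Fin n → Bool) (w : Fin n) → P w ≡ true → (∀ v → P v ≡ true → v ≡ w) →
  ∑Fin (indicator ∘ P) ≡ 1
∑Fin-unique P w Pw unique = trans (sumOver-cong (allFin _) agree) (∑Fin-point w)
  where
  agree : ∀ v → indicator (P v) ≡ indicator ⌊ v ≟ w ⌋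
  agree v with v ≟ w
  ... | yes refl rewrite Pw = refl
  ... | no v≢w with P v in Pv
  ...   | true  = ⊥-elim (v≢w (unique v Pv))
  ...   | false = refl

∑Where : ∀ {n} → (Fin n → Bool) → (Fin n → ℕ) → ℕ
∑Where P h = ∑Fin (λ v → indicator (P v) * h v)

∑Where-const : ∀ {n} (P : Fin n → Bool) {h : Fin n → ℕ} {c} → (∀ {v} → P v ≡ true → h v ≡ c) →
  ∑Where P h ≡ c * ∑Fin (indicator ∘ P)
∑Where-const {n} P {h} {c} const = trans (sumOver-cong (allFin n) pointwise) (sumOver-*ˡ (allFin n) c _)
  where
  pointwise : ∀ v → indicator (P v) * h v ≡ c * indicator (P v)
  pointwise v with P v in Pv
  ... | true  = trans (+-identityʳ (h v)) (trans (const Pv) (sym (*-identityʳ c)))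
  ... | false = sym (*-zeroʳ c)

sumBelow : ℕ → (ℕ → ℕ) → ℕ
sumBelow zero    f = 0
sumBelow (suc k) f = sumBelow k f + f k

sumBelow-cong : ∀ k {f g : ℕ → ℕ} → (∀ i → i < k → f i ≡ g i) → sumBelow k f ≡ sumBelow k g
sumBelow-cong zero    f≗g = refl
sumBelow-cong (suc k) f≗g = cong₂ _+_ (sumBelow-cong k (λ i i<k → f≗g i (m≤n⇒m≤1+n i<k))) (f≗g k ≤-refl)

sumBelow-+ : ∀ k (f g : ℕ → ℕ) → sumBelow k (λ i → f i + g i) ≡ sumBelow k f + sumBelow k g
sumBelow-+ zero    f g = refl
sumBelow-+ (suc k) f g =
  trans (cong (_+ (f k + g k)) (sumBelow-+ k f g)) (+-interchange (sumBelow k f) (sumBelow k g) (f k) (g k))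

sumBelow-*ˡ : ∀ k c (f : ℕ → ℕ) → sumBelow k (λ i → c * f i) ≡ c * sumBelow k f
sumBelow-*ˡ zero    c f = sym (*-zeroʳ c)
sumBelow-*ˡ (suc k) c f =
  trans (cong (_+ c * f k) (sumBelow-*ˡ k c f)) (sym (*-distribˡ-+ c (sumBelow k f) (f k)))

sumBelow-zero : ∀ k → sumBelow k (λ _ → 0) ≡ 0
sumBelow-zero zero    = refl
sumBelow-zero (suc k) = trans (+-identityʳ _) (sumBelow-zero k)

sumBelow-const-1 : ∀ k → sumBelow k (λ _ → 1) ≡ k
sumBelow-const-1 zero    = refl
sumBelow-const-1 (suc k) = trans (cong (_+ 1) (sumBelow-const-1 k)) (+-comm k 1)

sumBelow-point : ∀ k {m} (f : ℕ → ℕ) → m < k → sumBelow k (λ i → indicator ⌊ m ≟ℕ i ⌋ * f i) ≡ f m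
sumBelow-point (suc k) {m} f m<1+k with m ≟ℕ k
... | yes refl = cong₂ _+_ (trans (sumBelow-cong m off) (sumBelow-zero m)) (+-identityʳ (f m))
  where
  off : ∀ i → i < m → indicator ⌊ m ≟ℕ i ⌋ * f i ≡ 0
  off i i<m with m ≟ℕ i
  ... | yes refl = ⊥-elim (<-irrefl refl i<m)
  ... | no _     = refl
... | no m≢k = trans (+-identityʳ _) (sumBelow-point k f (≤∧≢⇒< (≤-pred m<1+k) m≢k))

∑Fin-sumBelow : ∀ {n} k (F : Fin n → ℕ → ℕ) →
  ∑Fin (λ v → sumBelow k (F v)) ≡ sumBelow k (λ i → ∑Fin (λ v → F v i))
∑Fin-sumBelow {n} zero    F = sumOver-zero (allFin n)
∑Fin-sumBelow {n} (suc k) F =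
  trans (sumOver-+ (allFin n) _ _) (cong (_+ ∑Fin (λ v → F v k)) (∑Fin-sumBelow k F))

sumBelow-suc : ∀ k (f : ℕ → ℕ) → sumBelow (suc k) f ≡ f 0 + sumBelow k (f ∘ suc)
sumBelow-suc zero    f = +-comm 0 (f 0)
sumBelow-suc (suc k) f = trans (cong (_+ f (suc k)) (sumBelow-suc k f)) (+-assoc (f 0) _ _)

sumBelow-reverse : ∀ k (f : ℕ → ℕ) → sumBelow (suc k) (λ i → f (k ∸ i)) ≡ sumBelow (suc k) f
sumBelow-reverse zero    f = refl
sumBelow-reverse (suc k) f = trans (sumBelow-suc (suc k) (λ i → f (suc k ∸ i)))
  (trans (cong (f (suc k) +_) (sumBelow-reverse k f)) (+-comm (f (suc k)) _))

Unique-∷ʳ : ∀ {A : Set} (xs : List A) {a : A} → Unique xs → All (a ≢_) xs → Unique (xs ∷ʳ a)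
Unique-∷ʳ []       []         []           = [] ∷ []
Unique-∷ʳ (x ∷ xs) (x∉ ∷ uxs) (a≢x ∷ a∉xs) = ∷ʳ⁺ x∉ (≢-sym a≢x) ∷ Unique-∷ʳ xs uxs a∉xs

module Distance {n : ℕ} (G : SimpleGraph n) where

  infix 4 _∼_
  _∼_ : Fin n → Fin n → Set
  u ∼ v = adj G u v ≡ true

  Reach : ℕ → Fin n → Fin n → Set
  Reach k u v = reach G k u v ≡ true

  ∼-sym : ∀ {u v} → u ∼ v → v ∼ u
  ∼-sym {u} {v} u∼v = trans (adj-sym G v u) u∼v

  ∼⇒≢ : ∀ {u v} → u ∼ v → u ≢ v
  ∼⇒≢ {u} u∼u refl with trans (sym u∼u) (irrefl G u)
  ... | ()

  reach-refl : ∀ u → Reach 0 u u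
  reach-refl u with u ≟ u
  ... | yes _  = refl
  ... | no u≢u = ⊥-elim (u≢u refl)

  reach-zero⇒≡ : ∀ u v → Reach 0 u v → u ≡ v
  reach-zero⇒≡ u v r with u ≟ v
  ... | yes u≡v = u≡v

  reach-suc : ∀ k u v → Reach k u v → Reach (suc k) u v
  reach-suc k u v r rewrite r = refl

  reach-step : ∀ k u w v → u ∼ w → Reach k w v → Reach (suc k) u v
  reach-step k u w v u∼w r with reach G k u v
  ... | true  = refl
  ... | false = to T-≡ (any⁺ _ (tabulate⁺ w (from T-≡ (cong₂ _∧_ u∼w r))))

  reach-suc⁻ : ∀ k u v → Reach (suc k) u v → Reach k u v ⊎ Σ (Fin n) λ w → u ∼ w × Reach k w v
  reach-suc⁻ k u v r with reach G k u v
  ... | true  = inj₁ refl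
  ... | false with satisfied (any⁻ _ (allFin n) (from T-≡ r))
  ...   | w , _ with adj G u w in u∼w | reach G k w v in w→v
  ...     | true | true = inj₂ (w , u∼w , w→v)

  reach-trans : ∀ i j u w v → Reach i u w → Reach j w v → Reach (i + j) u v
  reach-trans zero    j u w v r₁ r₂ rewrite reach-zero⇒≡ u w r₁ = r₂
  reach-trans (suc i) j u w v r₁ r₂ with reach-suc⁻ i u w r₁
  ... | inj₁ r            = reach-suc (i + j) u v (reach-trans i j u w v r r₂)
  ... | inj₂ (w′ , a , r) = reach-step (i + j) u w′ v a (reach-trans i j w′ w v r r₂)

  reach-snoc : ∀ k u w v → Reach k u w → w ∼ v → Reach (suc k) u v
  reach-snoc k u w v r w∼v = subst (λ m → Reach m u v) (+-comm k 1)
    (reach-trans k 1 u w v r (reach-step 0 w v v w∼v (reach-refl v)))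

  reach-sym : ∀ k u v → Reach k u v → Reach k v u
  reach-sym zero    u v r rewrite reach-zero⇒≡ u v r = reach-refl v
  reach-sym (suc k) u v r with reach-suc⁻ k u v r
  ... | inj₁ r′           = reach-suc k v u (reach-sym k u v r′)
  ... | inj₂ (w , a , r′) = reach-snoc k v w u (reach-sym k w v r′) (∼-sym a)

  searchDist-least : ∀ f j k u v → j ≤ k → Reach k u v → searchDist G f j u v ≤ k
  searchDist-least zero    j k u v j≤k r = j≤k
  searchDist-least (suc f) j k u v j≤k r with reach G j u v in eq
  ... | true  = j≤k
  ... | false = searchDist-least f (suc j) k u v (≤∧≢⇒< j≤k j≢k) r
    where
    j≢k : j ≢ k
    j≢k refl with trans (sym eq) r
    ... | ()

  searchDist-reach : ∀ f j u v → Reach (j + f) u v → Reach (searchDist G f j u v) u v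
  searchDist-reach zero    j u v r = subst (λ m → Reach m u v) (+-identityʳ j) r
  searchDist-reach (suc f) j u v r with reach G j u v in eq
  ... | true  = eq
  ... | false = searchDist-reach f (suc j) u v (subst (λ m → Reach m u v) (+-suc j f) r)

  searchDist-≤ : ∀ f j u v → searchDist G f j u v ≤ j + f
  searchDist-≤ zero    j u v = ≤-reflexive (sym (+-identityʳ j))
  searchDist-≤ (suc f) j u v with reach G j u v
  ... | true  = m≤m+n j (suc f)
  ... | false = subst (searchDist G f (suc j) u v ≤_) (sym (+-suc j f)) (searchDist-≤ f (suc j) u v)

  d : Fin n → Fin n → ℕ
  d = dist G

  dist-least : ∀ k {u v} → Reach k u v → d u v ≤ k
  dist-least k {u} {v} = searchDist-least n 0 k u v z≤n

  dist≤n : ∀ u v → d u v ≤ n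
  dist≤n = searchDist-≤ n 0

  dist-refl : ∀ u → d u u ≡ 0
  dist-refl u = n≤0⇒n≡0 (dist-least 0 (reach-refl u))

  transmission : Fin n → ℕ
  transmission u = ∑Fin (d u)

  module Metric (connected : Connected G) where

    dist-reach : ∀ u v → Reach (d u v) u v
    dist-reach u v = searchDist-reach n 0 u v (to T-≡ (connected u v))

    dist≡0⇒≡ : ∀ {u v} → d u v ≡ 0 → u ≡ v
    dist≡0⇒≡ {u} {v} e = reach-zero⇒≡ u v (subst (λ m → Reach m u v) e (dist-reach u v))

    dist-sym : ∀ u v → d u v ≡ d v u
    dist-sym u v = ≤-antisym (dist-least _ (reach-sym (d v u) v u (dist-reach v u)))
                             (dist-least _ (reach-sym (d u v) u v (dist-reach u v)))

    dist-triangle : ∀ u w v → d u v ≤ d u w + d w v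
    dist-triangle u w v = dist-least _ (reach-trans (d u w) (d w v) u w v (dist-reach u w) (dist-reach w v))

    dist-∼-≤ : ∀ {u v} → u ∼ v → d u v ≤ 1
    dist-∼-≤ {u} {v} u∼v = dist-least 1 (reach-step 0 u v v u∼v (reach-refl v))

    dist-pos : ∀ {u v} → u ≢ v → 1 ≤ d u v
    dist-pos {u} {v} u≢v with d u v in eq
    ... | zero  = ⊥-elim (u≢v (dist≡0⇒≡ eq))
    ... | suc _ = s≤s z≤n

    dist-∼ : ∀ {u v} → u ∼ v → d u v ≡ 1
    dist-∼ u∼v = ≤-antisym (dist-∼-≤ u∼v) (dist-pos (∼⇒≢ u∼v))

    dist-∼-step : ∀ w {u v} → u ∼ v → d w v ≤ suc (d w u)
    dist-∼-step w {u} {v} u∼v = begin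
      d w v         ≤⟨ dist-triangle w u v ⟩
      d w u + d u v ≤⟨ +-monoʳ-≤ (d w u) (dist-∼-≤ u∼v) ⟩
      d w u + 1     ≡⟨ +-comm (d w u) 1 ⟩
      suc (d w u)   ∎
      where open ≤-Reasoning

    dist-∼-stepʳ : ∀ w {u v} → u ∼ v → d v w ≤ suc (d u w)
    dist-∼-stepʳ w {u} {v} u∼v =
      subst₂ (λ l r → l ≤ suc r) (dist-sym w v) (dist-sym w u) (dist-∼-step w u∼v)

    geodesic-step : ∀ k {u v} → d u v ≡ suc k → Σ (Fin n) λ w → u ∼ w × d w v ≡ k
    geodesic-step k {u} {v} e with reach-suc⁻ k u v (subst (λ m → Reach m u v) e (dist-reach u v))
    ... | inj₁ r = ⊥-elim (<-irrefl refl (≤-trans (≤-reflexive (sym e)) (dist-least k r)))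
    ... | inj₂ (w , u∼w , r) = w , u∼w , ≤-antisym (dist-least k r) k≤dwv
      where
      k≤dwv : k ≤ d w v
      k≤dwv = ≤-pred (begin
        suc k         ≡⟨ sym e ⟩
        d u v         ≤⟨ dist-triangle u w v ⟩
        d u w + d w v ≤⟨ +-monoˡ-≤ (d w v) (dist-∼-≤ u∼w) ⟩
        suc (d w v)   ∎)
        where open ≤-Reasoning

    dist≡1⇒∼ : ∀ {u v} → d u v ≡ 1 → u ∼ v
    dist≡1⇒∼ e with geodesic-step 0 e
    ... | w , u∼w , dwv≡0 rewrite dist≡0⇒≡ dwv≡0 = u∼w

module Degree {n : ℕ} (G : SimpleGraph n) where
  open Distance G

  otherNeighbours : Fin n → Fin n → ℕ
  otherNeighbours v p = ∑Fin (λ u → indicator (adj G v u ∧ not ⌊ u ≟ p ⌋))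

  degree-split : ∀ {v p} → v ∼ p → degree G v ≡ suc (otherNeighbours v p)
  degree-split {v} {p} v∼p =
    trans (sumOver-cong (allFin n) split)
          (trans (sumOver-+ (allFin n) _ _) (cong (_+ otherNeighbours v p) (∑Fin-point p)))
    where
    split : ∀ u → indicator (adj G v u) ≡ indicator ⌊ u ≟ p ⌋ + indicator (adj G v u ∧ not ⌊ u ≟ p ⌋)
    split u with u ≟ p
    ... | yes refl rewrite v∼p = refl
    ... | no _ with adj G v u
    ...   | true  = refl
    ...   | false = refl

  neighbour : ∀ v → 1 ≤ degree G v → Σ (Fin n) λ p → v ∼ p
  neighbour v deg≥1 with sumOver-positive (allFin n) (λ w → indicator (adj G v w)) deg≥1
  ... | p , pos with adj G v p in v∼p
  ...   | true = p , v∼p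

  another-neighbour : ∀ {v p} → v ∼ p → 2 ≤ degree G v → Σ (Fin n) λ w → v ∼ w × w ≢ p
  another-neighbour {v} {p} v∼p deg≥2
    with sumOver-positive (allFin n) _ (≤-pred (≤-trans deg≥2 (≤-reflexive (degree-split v∼p))))
  ... | w , pos with adj G v w in v∼w | w ≟ p
  ...   | true | no w≢p = w , v∼w , w≢p

  non-leaf-degree : ∀ {v p} → v ∼ p → ¬ IsLeaf G v → 2 ≤ degree G v
  non-leaf-degree v∼p nonleaf = ≤∧≢⇒< (subst (1 ≤_) (sym (degree-split v∼p)) (s≤s z≤n)) (nonleaf ∘ sym)

  leaf-neighbour-unique : ∀ {v p w} → IsLeaf G v → v ∼ p → v ∼ w → w ≡ p
  leaf-neighbour-unique {v} {p} {w} leaf v∼p v∼w with w ≟ p in w≟p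
  ... | yes w≡p = w≡p
  ... | no  w≢p = ⊥-elim (<-irrefl refl (begin
    1                      ≡⟨ cong₂ (λ a b → indicator (a ∧ not ⌊ b ⌋)) (sym v∼w) (sym w≟p) ⟩
    indicator (adj G v w ∧ not ⌊ w ≟ p ⌋) ≤⟨ sumOver-≥-member _ (∈-allFin w) ⟩
    otherNeighbours v p    ≡⟨ suc-injective (trans (sym (degree-split v∼p)) leaf) ⟩
    0                      ∎))
    where open ≤-Reasoning

module RootedTree {n : ℕ} (G : SimpleGraph n) (connected : Connected G) (acyclic : Acyclic G)
                  (root : Fin n) where
  open Distance G
  open Metric connected
  open Degree G

  depth : Fin n → ℕ
  depth = d root

  parent : ∀ {v k} → depth v ≡ suc k → Σ (Fin n) λ p → v ∼ p × depth p ≡ k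
  parent {v} {k} e with geodesic-step k (trans (dist-sym v root) e)
  ... | p , v∼p , e′ = p , v∼p , trans (dist-sym root p) e′

  walk-∷ʳ : ∀ s L {a} → IsWalk G (s ∷ L) → lastOr G s L ∼ a → IsWalk G (s ∷ (L ∷ʳ a))
  walk-∷ʳ s []      w s∼a        = from T-≡ s∼a , tt
  walk-∷ʳ s (y ∷ L) (s∼y , w) y∼a = s∼y , walk-∷ʳ y L w y∼a

  lastOr-∷ʳ : ∀ s L a → lastOr G s (L ∷ʳ a) ≡ a
  lastOr-∷ʳ s []      a = refl
  lastOr-∷ʳ s (y ∷ L) a = lastOr-∷ʳ y L a

  ∉-deeper : ∀ {k z} L → depth z ≡ k → All (λ w → suc k ≤ depth w) L → All (z ≢_) L
  ∉-deeper L dz = All.map (λ h z≡w → <-irrefl refl (≤-trans h (≤-reflexive (trans (cong depth (sym z≡w)) dz))))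

  -- Moving both ends to their parents either closes a cycle (common parent) or gives such a
  -- path one level up; at the root the two ends would coincide.
  no-path-between-equal-depths : ∀ k s t (L : List (Fin n)) → s ≢ t → depth s ≡ k → depth t ≡ k →
    Unique (s ∷ L) → IsWalk G (s ∷ L) → lastOr G s L ≡ t → All (λ w → k ≤ depth w) (s ∷ L) → ⊥
  no-path-between-equal-depths zero s t L s≢t ds dt _ _ _ _ =
    s≢t (trans (sym (dist≡0⇒≡ ds)) (dist≡0⇒≡ dt))
  no-path-between-equal-depths (suc k) s t L s≢t ds dt unique walk end deep
    with parent ds | parent dt
  ... | ps , s∼ps , dps | pt , t∼pt , dpt with ps ≟ pt
  ... | yes refl = acyclic ps (s ∷ L)
        (∉-deeper (s ∷ L) dps deep ∷ unique , (from T-≡ (∼-sym s∼ps) , walk) , two L end ,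
         from T-≡ (subst (_∼ ps) (sym end) t∼pt))
    where
    two : ∀ L → lastOr G s L ≡ t → 2 ≤ length (s ∷ L)
    two []      e = ⊥-elim (s≢t e)
    two (_ ∷ _) e = s≤s (s≤s z≤n)
  ... | no ps≢pt = no-path-between-equal-depths k ps pt (s ∷ (L ∷ʳ pt)) ps≢pt dps dpt
        unique′ walk′ (lastOr-∷ʳ s L pt) deep′
    where
    unique′ : Unique (ps ∷ s ∷ (L ∷ʳ pt))
    unique′ = ∷ʳ⁺ (∉-deeper (s ∷ L) dps deep) ps≢pt ∷ Unique-∷ʳ (s ∷ L) unique (∉-deeper (s ∷ L) dpt deep)
    walk′ : IsWalk G (ps ∷ s ∷ (L ∷ʳ pt))
    walk′ = from T-≡ (∼-sym s∼ps) , walk-∷ʳ s L walk (subst (_∼ pt) (sym end) t∼pt)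
    deep′ : All (λ w → k ≤ depth w) (ps ∷ s ∷ (L ∷ʳ pt))
    deep′ = ≤-reflexive (sym dps) ∷ ∷ʳ⁺ (All.map (≤-trans (n≤1+n k)) deep) (≤-reflexive (sym dpt))

  adjacent-depths-differ : ∀ {u v} → u ∼ v → depth u ≢ depth v
  adjacent-depths-differ {u} {v} u∼v e = no-path-between-equal-depths (depth u) u v (v ∷ []) (∼⇒≢ u∼v)
    refl (sym e) ((∼⇒≢ u∼v ∷ []) ∷ [] ∷ []) (from T-≡ u∼v , tt) refl (≤-refl ∷ ≤-reflexive e ∷ [])

  parent-unique : ∀ {v w₁ w₂ k} → depth v ≡ suc k → v ∼ w₁ → v ∼ w₂ → depth w₁ ≡ k → depth w₂ ≡ k →
    w₁ ≡ w₂
  parent-unique {v} {w₁} {w₂} {k} dv v∼w₁ v∼w₂ d₁ d₂ with w₁ ≟ w₂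
  ... | yes w₁≡w₂ = w₁≡w₂
  ... | no  w₁≢w₂ = ⊥-elim (no-path-between-equal-depths k w₁ w₂ (v ∷ w₂ ∷ []) w₁≢w₂ d₁ d₂
        ((≢v d₁ ∷ w₁≢w₂ ∷ []) ∷ (≢-sym (≢v d₂) ∷ []) ∷ [] ∷ [])
        (from T-≡ (∼-sym v∼w₁) , from T-≡ v∼w₂ , tt) refl
        (≤-reflexive (sym d₁) ∷ ≤-trans (n≤1+n k) (≤-reflexive (sym dv)) ∷ ≤-reflexive (sym d₂) ∷ []))
    where
    ≢v : ∀ {w} → depth w ≡ k → w ≢ v
    ≢v dw w≡v = 1+n≢n (sym (trans (sym dw) (trans (cong depth w≡v) dv)))

  adjacent-depth : ∀ {u v} → u ∼ v → depth v ≡ suc (depth u) ⊎ depth u ≡ suc (depth v)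
  adjacent-depth {u} {v} u∼v with <-cmp (depth u) (depth v)
  ... | tri< lt _ _ = inj₁ (≤-antisym (dist-∼-step root u∼v) lt)
  ... | tri≈ _ eq _ = ⊥-elim (adjacent-depths-differ u∼v eq)
  ... | tri> _ _ gt = inj₂ (≤-antisym (dist-∼-step root (∼-sym u∼v)) gt)

  child : ∀ {v k} → depth v ≡ suc k → ¬ IsLeaf G v → Σ (Fin n) λ w → v ∼ w × depth w ≡ suc (suc k)
  child {v} {k} dv nonleaf with parent dv
  ... | p , v∼p , dp with another-neighbour v∼p (non-leaf-degree v∼p nonleaf)
  ...   | w , v∼w , w≢p with adjacent-depth v∼w
  ...     | inj₁ dw = w , v∼w , trans dw (cong suc dv)
  ...     | inj₂ dv≡ = ⊥-elim (w≢p (parent-unique dv v∼w v∼p (suc-injective (trans (sym dv≡) dv)) dp))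


module Leaves {n : ℕ} (G : SimpleGraph n) (connected : Connected G) where
  open Distance G
  open Metric connected
  open Degree G

  dist-from-leaf : ∀ {l p v} → IsLeaf G l → l ∼ p → v ≢ l → d l v ≡ suc (d p v)
  dist-from-leaf {l} {p} {v} leaf l∼p v≢l with d l v in dlv
  ... | zero  = ⊥-elim (v≢l (sym (dist≡0⇒≡ dlv)))
  ... | suc k with geodesic-step k dlv
  ...   | w , l∼w , dwv rewrite leaf-neighbour-unique leaf l∼p l∼w = cong suc (sym dwv)

  transmission-leaf : ∀ {l p} → IsLeaf G l → l ∼ p → transmission l + 2 ≡ n + transmission p
  transmission-leaf {l} {p} leaf l∼p = begin
    transmission l + 2
      ≡⟨ cong (transmission l +_) (trans (sumOver-*ˡ (allFin n) 2 _) (cong (2 *_) (∑Fin-point l))) ⟨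
    transmission l + ∑Fin (λ v → 2 * indicator ⌊ v ≟ l ⌋)
      ≡⟨ sumOver-+ (allFin n) _ _ ⟨
    ∑Fin (λ v → d l v + 2 * indicator ⌊ v ≟ l ⌋)
      ≡⟨ sumOver-cong (allFin n) via-p ⟩
    ∑Fin (λ v → 1 + d p v)
      ≡⟨ sumOver-+ (allFin n) _ _ ⟩
    ∑Fin {n} (λ _ → 1) + transmission p
      ≡⟨ cong (_+ transmission p) (∑Fin-const-1 n) ⟩
    n + transmission p ∎
    where
    open ≡-Reasoning
    via-p : ∀ v → d l v + 2 * indicator ⌊ v ≟ l ⌋ ≡ 1 + d p v
    via-p v with v ≟ l
    ... | yes refl rewrite dist-refl v | dist-∼ (∼-sym l∼p) = refl
    ... | no v≢l   = trans (+-identityʳ (d l v)) (dist-from-leaf leaf l∼p v≢l)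

  adjacent-leaves-cover : ∀ {s w t} → IsLeaf G s → s ∼ w → IsLeaf G w → t ≢ s → t ≡ w
  adjacent-leaves-cover {s} {w} {t} s-leaf s∼w w-leaf t≢s with t ≟ w
  ... | yes t≡w = t≡w
  ... | no  t≢w = ⊥-elim (m≢1+n+m (d s t) (trans (dist-from-leaf s-leaf s∼w t≢s)
                                               (cong suc (dist-from-leaf w-leaf (∼-sym s∼w) t≢w))))

  -- If m = 0 then u and its leaf neighbour make up the whole graph, so v is that leaf and m′ = 0.
  broom-degree-pos : ∀ {u v m m′} → u ≢ v → IsBroomVertex G u → degree G u ≡ suc m → degree G v ≡ suc m′ →
    2 ≤ m + m′ → 1 ≤ m
  broom-degree-pos {m = suc _} _ _ _ _ _ = s≤s z≤n
  broom-degree-pos {u} {v} {zero} {m′} u≢v (w , u∼w , w-leaf) deg-u deg-v 2≤m′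
    with adjacent-leaves-cover deg-u (to T-≡ u∼w) w-leaf (u≢v ∘ sym)
  ... | refl with trans (sym deg-v) w-leaf
  ...   | refl with 2≤m′
  ...     | ()

module _ {n : ℕ} (G : SimpleGraph n) where
  open Distance G

  forwardDist backwardDist : Fin n → Fin n → ℕ
  forwardDist  u v = indicator (does (u Fin.<? v)) * d u v
  backwardDist u v = indicator (does (v Fin.<? u)) * d u v

  wiener-∑Fin : wiener G ≡ ∑Fin (λ u → ∑Fin (forwardDist u))
  wiener-∑Fin =
    trans (sum-concatMap (allFin n) (λ u → map (d u) (filter (u Fin.<?_) (allFin n))))
          (sumOver-cong (allFin n) (λ u → sum-map-filter (allFin n) (u Fin.<?_) (d u)))

  dist-split : ∀ u v → d u v ≡ forwardDist u v + backwardDist u v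
  dist-split u v = split (u Fin.<? v) (v Fin.<? u)
    where
    split : (p : Dec (u Fin.< v)) (q : Dec (v Fin.< u)) →
            d u v ≡ indicator (does p) * d u v + indicator (does q) * d u v
    split (yes u<v) (yes v<u) = ⊥-elim (Finₚ.<-asym u<v v<u)
    split (yes _)   (no _)    = sym (trans (+-identityʳ _) (+-identityʳ _))
    split (no _)    (yes _)   = sym (+-identityʳ _)
    split (no u≮v)  (no v≮u) with Finₚ.<-cmp u v
    ... | tri< u<v _ _  = ⊥-elim (u≮v u<v)
    ... | tri> _ _ v<u  = ⊥-elim (v≮u v<u)
    ... | tri≈ _ refl _ = dist-refl u

  wiener-double : Connected G → wiener G + wiener G ≡ ∑Fin transmission
  wiener-double connected = sym (begin
    ∑Fin (λ u → ∑Fin (d u))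
      ≡⟨ sumOver-cong (allFin n) (λ u → trans (sumOver-cong (allFin n) (dist-split u)) (sumOver-+ (allFin n) _ _)) ⟩
    ∑Fin (λ u → ∑Fin (forwardDist u) + ∑Fin (backwardDist u))
      ≡⟨ sumOver-+ (allFin n) _ _ ⟩
    ∑Fin (λ u → ∑Fin (forwardDist u)) + ∑Fin (λ u → ∑Fin (backwardDist u))
      ≡⟨ cong (∑Fin (λ u → ∑Fin (forwardDist u)) +_) (trans (sumOver-comm (allFin n) (allFin n) backwardDist)
           (sumOver-cong (allFin n) λ v → sumOver-cong (allFin n) λ u →
             cong (indicator (does (v Fin.<? u)) *_) (Metric.dist-sym connected u v))) ⟩
    ∑Fin (λ u → ∑Fin (forwardDist u)) + ∑Fin (λ v → ∑Fin (forwardDist v))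
      ≡⟨ cong₂ _+_ wiener-∑Fin wiener-∑Fin ⟨
    wiener G + wiener G ∎)
    where open ≡-Reasoning

pathBroomTransmission : ℕ → ℕ → ℕ → ℕ → ℕ
pathBroomTransmission D a b i = sumBelow (suc D) (λ j → ∣ i - j ∣) + (suc i * a + suc (D ∸ i) * b)

module DoubleBroom {n : ℕ} (G : SimpleGraph n) (connected : Connected G) (acyclic : Acyclic G)
  {x y : Fin n} (x≢y : x ≢ y) (brooms : ∀ z → IsBroomVertex G z → z ≡ x ⊎ z ≡ y)
  {a b : ℕ} (deg-x : degree G x ≡ suc a) (deg-y : degree G y ≡ suc b) (a≥1 : 1 ≤ a) (b≥1 : 1 ≤ b)
  where
  open Distance G
  open Metric connected
  open Degree G
  open Leaves G connected
  open RootedTree G connected acyclic x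

  D : ℕ
  D = d x y

  toY : Fin n → ℕ
  toY v = d v y

  -- The spine is the x–y geodesic: the vertices where the triangle inequality through v is tight.
  OnSpine : Fin n → Set
  OnSpine v = depth v + toY v ≡ D

  spine-lower : ∀ v → D ≤ depth v + toY v
  spine-lower v = dist-triangle x v y

  x-on-spine : OnSpine x
  x-on-spine = cong (_+ D) (dist-refl x)

  y-on-spine : OnSpine y
  y-on-spine = trans (cong (D +_) (dist-refl y)) (+-identityʳ D)

  toY-on-spine : ∀ {v} → OnSpine v → toY v ≡ D ∸ depth v
  toY-on-spine {v} on = trans (sym (m+n∸m≡n (depth v) (toY v))) (cong (_∸ depth v) on)

  spine-next : ∀ {v e} → OnSpine v → toY v ≡ suc e →
    Σ (Fin n) λ w → v ∼ w × toY w ≡ e × depth w ≡ suc (depth v) × OnSpine w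
  spine-next {v} {e} on tv with geodesic-step e tv
  ... | w , v∼w , tw = w , v∼w , tw , dw , trans (cong₂ _+_ dw tw) (trans (sym (+-suc (depth v) e)) on′)
    where
    on′ : depth v + suc e ≡ D
    on′ = trans (cong (depth v +_) (sym tv)) on
    dw : depth w ≡ suc (depth v)
    dw = ≤-antisym (dist-∼-step x v∼w) (+-cancelʳ-≤ e _ _ (begin
      suc (depth v) + e ≡⟨ +-suc (depth v) e ⟨
      depth v + suc e   ≡⟨ on′ ⟩
      D                 ≤⟨ spine-lower w ⟩
      depth w + toY w   ≡⟨ cong (depth w +_) tw ⟩
      depth w + e       ∎))
      where open ≤-Reasoning

  spine-prev : ∀ {v k} → OnSpine v → depth v ≡ suc k → Σ (Fin n) λ p → v ∼ p × depth p ≡ k × OnSpine p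
  spine-prev {v} {k} on dv with parent dv
  ... | p , v∼p , dp = p , v∼p , dp , ≤-antisym (begin
      depth p + toY p       ≤⟨ +-mono-≤ (≤-reflexive dp) (dist-∼-stepʳ y v∼p) ⟩
      k + suc (toY v)       ≡⟨ +-suc k (toY v) ⟩
      suc k + toY v         ≡⟨ cong (_+ toY v) dv ⟨
      depth v + toY v       ≡⟨ on ⟩
      D                     ∎) (spine-lower p)
    where open ≤-Reasoning

  toY-determined : ∀ {u v} → OnSpine u → OnSpine v → depth u ≡ depth v → toY u ≡ toY v
  toY-determined {u} {v} on-u on-v du≡dv =
    +-cancelˡ-≡ (depth u) _ _ (trans on-u (trans (sym on-v) (cong (_+ toY v) (sym du≡dv))))

  spine-unique : ∀ e {u v} → toY u ≡ e → OnSpine u → OnSpine v → depth u ≡ depth v → u ≡ v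
  spine-unique zero    tu on-u on-v du≡dv =
    trans (dist≡0⇒≡ tu) (sym (dist≡0⇒≡ (trans (sym (toY-determined on-u on-v du≡dv)) tu)))
  spine-unique (suc e) {u} {v} tu on-u on-v du≡dv
    with spine-next on-u tu | spine-next on-v (trans (sym (toY-determined on-u on-v du≡dv)) tu)
  ... | w , u∼w , tw , dw , on-w | w′ , v∼w′ , _ , dw′ , on-w′
    with spine-unique e tw on-w on-w′ (trans dw (trans (cong suc du≡dv) (sym dw′)))
  ... | refl = parent-unique dw (∼-sym u∼w) (∼-sym v∼w′) refl (sym du≡dv)

  spine-unique-toY : ∀ {u v} → OnSpine u → OnSpine v → toY u ≡ toY v → u ≡ v
  spine-unique-toY {u} {v} on-u on-v tu≡tv = spine-unique _ refl on-u on-v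
    (+-cancelʳ-≡ (toY u) _ _ (trans on-u (trans (sym on-v) (cong (depth v +_) (sym tu≡tv)))))

  spine-exists : ∀ e → e ≤ D → Σ (Fin n) λ v → OnSpine v × toY v ≡ e
  spine-exists zero    _   = y , y-on-spine , dist-refl y
  spine-exists (suc e) e<D with spine-exists e (≤-trans (n≤1+n e) e<D)
  ... | v , on-v , tv with zero-or-suc (depth v)
  ...   | inj₁ dv = ⊥-elim (<-irrefl refl (≤-trans e<D (≤-reflexive (trans (sym on-v) (cong₂ _+_ dv tv)))))
  ...   | inj₂ (k , dv) with spine-prev on-v dv
  ...     | p , _ , dp , on-p = p , on-p , +-cancelˡ-≡ k _ _ (begin
    k + toY p             ≡⟨ cong (_+ toY p) dp ⟨
    depth p + toY p       ≡⟨ on-p ⟩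
    D                     ≡⟨ on-v ⟨
    depth v + toY v       ≡⟨ cong₂ _+_ dv tv ⟩
    suc k + e             ≡⟨ +-suc k e ⟨
    k + suc e             ∎)
    where open ≡-Reasoning

  -- Walking away from x through non-leaves must stop at a broom vertex, which can only be y;
  -- the fuel bounds the walk by the depth bound n.
  descent-reaches-y : ∀ fuel {v k} → n ≤ fuel + depth v → depth v ≡ suc k → ¬ IsLeaf G v → OnSpine v
  descent-reaches-y fuel {v} {k} bound dv nonleaf with child dv nonleaf
  ... | w , v∼w , dw with degree G w ≟ℕ 1
  ...   | yes w-leaf with brooms v (w , from T-≡ v∼w , w-leaf)
  ...     | inj₁ refl = ⊥-elim (0≢1+n (trans (sym (dist-refl x)) dv))
  ...     | inj₂ refl = y-on-spine
  descent-reaches-y zero {v} {k} bound dv nonleaf | w , v∼w , dw | no _ =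
    ⊥-elim (<-irrefl refl (begin-strict
      depth v   <⟨ ≤-reflexive (trans (cong suc dv) (sym dw)) ⟩
      depth w   ≤⟨ dist≤n x w ⟩
      n         ≤⟨ bound ⟩
      depth v   ∎))
    where open ≤-Reasoning
  descent-reaches-y (suc fuel) {v} {k} bound dv nonleaf | w , v∼w , dw | no w-nonleaf =
    ≤-antisym (begin
      depth v + toY v       ≤⟨ +-monoʳ-≤ (depth v) (dist-∼-stepʳ y (∼-sym v∼w)) ⟩
      depth v + suc (toY w) ≡⟨ +-suc (depth v) (toY w) ⟩
      suc (depth v) + toY w ≡⟨ cong (λ m → suc m + toY w) dv ⟩
      suc (suc k) + toY w   ≡⟨ cong (_+ toY w) dw ⟨
      depth w + toY w       ≡⟨ on-w ⟩
      D                     ∎) (spine-lower v)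
    where
    open ≤-Reasoning
    on-w : OnSpine w
    on-w = descent-reaches-y fuel (≤-trans bound (≤-reflexive (begin-equality
      suc fuel + depth v    ≡⟨ +-suc fuel (depth v) ⟨
      fuel + suc (depth v)  ≡⟨ cong (λ m → fuel + suc m) dv ⟩
      fuel + suc (suc k)    ≡⟨ cong (fuel +_) dw ⟨
      fuel + depth w        ∎))) dw w-nonleaf

  XLeaf YLeaf : Fin n → Set
  XLeaf v = IsLeaf G v × x ∼ v
  YLeaf v = IsLeaf G v × y ∼ v

  classify : ∀ v → OnSpine v ⊎ XLeaf v ⊎ YLeaf v
  classify v with degree G v ≟ℕ 1
  ... | yes leaf with neighbour v (≤-reflexive (sym leaf))
  ...   | p , v∼p with brooms p (v , from T-≡ (∼-sym v∼p) , leaf)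
  ...     | inj₁ refl = inj₂ (inj₁ (leaf , ∼-sym v∼p))
  ...     | inj₂ refl = inj₂ (inj₂ (leaf , ∼-sym v∼p))
  classify v | no nonleaf with zero-or-suc (depth v)
  ... | inj₁ dv       = inj₁ (subst OnSpine (dist≡0⇒≡ dv) x-on-spine)
  ... | inj₂ (k , dv) = inj₁ (descent-reaches-y n (m≤m+n n (depth v)) dv nonleaf)

  spine-non-leaf : ∀ {v} → OnSpine v → ¬ IsLeaf G v
  spine-non-leaf {v} on leaf with zero-or-suc (depth v)
  ... | inj₁ dv with dist≡0⇒≡ dv
  ...   | refl = <-irrefl refl (≤-trans (s≤s a≥1) (≤-reflexive (trans (sym deg-x) leaf)))
  spine-non-leaf {v} on leaf | inj₂ (k , dv) with zero-or-suc (toY v)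
  ... | inj₁ tv with dist≡0⇒≡ tv
  ...   | refl = <-irrefl refl (≤-trans (s≤s b≥1) (≤-reflexive (trans (sym deg-y) leaf)))
  spine-non-leaf {v} on leaf | inj₂ (k , dv) | inj₂ (e , tv) with spine-prev on dv | spine-next on tv
  ... | p , v∼p , dp , _ | w , v∼w , _ , dw , _ =
    m≢1+n+m k (begin
      k               ≡⟨ dp ⟨
      depth p         ≡⟨ cong depth (leaf-neighbour-unique leaf v∼p v∼w) ⟨
      depth w         ≡⟨ dw ⟩
      suc (depth v)   ≡⟨ cong suc dv ⟩
      suc (suc k)     ∎)
    where open ≡-Reasoning

  -- Off the spine every vertex is a leaf at x or at y, so yLeaf? need not test adjacency to y.
  onSpine? xLeaf? yLeaf? : Fin n → Bool
  onSpine? v = ⌊ depth v + toY v ≟ℕ D ⌋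
  xLeaf? v   = not (onSpine? v) ∧ adj G x v
  yLeaf? v   = not (onSpine? v) ∧ not (adj G x v)

  onSpine?-sound : ∀ {v} → onSpine? v ≡ true → OnSpine v
  onSpine?-sound e = toWitness (from T-≡ e)

  onSpine?-complete : ∀ {v} → OnSpine v → onSpine? v ≡ true
  onSpine?-complete on = to T-≡ (fromWitness on)

  off-spine : ∀ {v} → onSpine? v ≡ false → XLeaf v ⊎ YLeaf v
  off-spine {v} off with classify v
  ... | inj₁ on with trans (sym (onSpine?-complete on)) off
  ...   | ()
  off-spine off | inj₂ leaf = leaf

  xLeaf?-sound : ∀ {v} → xLeaf? v ≡ true → XLeaf v
  xLeaf?-sound {v} x∼v with onSpine? v in off
  xLeaf?-sound {v} () | true
  xLeaf?-sound {v} x∼v | false with off-spine off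
  ... | inj₁ xleaf        = xleaf
  ... | inj₂ (leaf , y∼v) = ⊥-elim (x≢y (leaf-neighbour-unique leaf (∼-sym y∼v) (∼-sym x∼v)))

  yLeaf?-sound : ∀ {v} → yLeaf? v ≡ true → YLeaf v
  yLeaf?-sound {v} x≁v with onSpine? v in off
  yLeaf?-sound {v} () | true
  yLeaf?-sound {v} x≁v | false with off-spine off
  ... | inj₂ yleaf = yleaf
  ... | inj₁ (_ , x∼v) with trans (sym (cong not x∼v)) x≁v
  ...   | ()

  spine-path : ∀ j {u v} → OnSpine u → OnSpine v → depth v ≡ depth u + j → d u v ≤ j
  spine-path zero    {u} on-u on-v dv with spine-unique _ refl on-u on-v (sym (trans dv (+-identityʳ _)))
  ... | refl = ≤-reflexive (dist-refl u)
  spine-path (suc j) {u} {v} on-u on-v dv with spine-prev on-v (trans dv (+-suc (depth u) j))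
  ... | p , v∼p , dp , on-p = begin
    d u v         ≤⟨ dist-triangle u p v ⟩
    d u p + d p v ≤⟨ +-mono-≤ (spine-path j on-u on-p dp) (dist-∼-≤ (∼-sym v∼p)) ⟩
    j + 1         ≡⟨ +-comm j 1 ⟩
    suc j         ∎
    where open ≤-Reasoning

  spine-dist-≤ : ∀ {u v} → OnSpine u → OnSpine v → depth u ≤ depth v → d u v ≡ depth v ∸ depth u
  spine-dist-≤ {u} {v} on-u on-v du≤dv = ≤-antisym
    (spine-path (depth v ∸ depth u) on-u on-v (sym (m+[n∸m]≡n du≤dv)))
    (begin
      depth v ∸ depth u             ≤⟨ ∸-monoˡ-≤ (depth u) (dist-triangle x u v) ⟩
      depth u + d u v ∸ depth u     ≡⟨ m+n∸m≡n (depth u) (d u v) ⟩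
      d u v                         ∎)
    where open ≤-Reasoning

  spine-dist : ∀ {u v} → OnSpine u → OnSpine v → d u v ≡ ∣ depth u - depth v ∣
  spine-dist {u} {v} on-u on-v with ≤-total (depth u) (depth v)
  ... | inj₁ du≤dv = trans (spine-dist-≤ on-u on-v du≤dv) (sym (m≤n⇒∣m-n∣≡n∸m du≤dv))
  ... | inj₂ dv≤du = trans (dist-sym u v) (trans (spine-dist-≤ on-v on-u dv≤du) (sym (m≤n⇒∣n-m∣≡n∸m dv≤du)))

  dist-spine-xLeaf : ∀ {u v} → OnSpine u → XLeaf v → d u v ≡ suc (depth u)
  dist-spine-xLeaf {u} {v} on (leaf , x∼v) = trans (dist-sym u v)
    (dist-from-leaf leaf (∼-sym x∼v) (λ { refl → spine-non-leaf on leaf }))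

  dist-spine-yLeaf : ∀ {u v} → OnSpine u → YLeaf v → d u v ≡ suc (toY u)
  dist-spine-yLeaf {u} {v} on (leaf , y∼v) = trans (dist-sym u v)
    (trans (dist-from-leaf leaf (∼-sym y∼v) (λ { refl → spine-non-leaf on leaf })) (cong suc (dist-sym y u)))

  spine-at-depth : ∀ {i} → i ≤ D → ∑Fin (λ v → indicator (onSpine? v ∧ ⌊ depth v ≟ℕ i ⌋)) ≡ 1
  spine-at-depth {i} i≤D with spine-exists (D ∸ i) (m∸n≤m D i)
  ... | w , on-w , tw = ∑Fin-unique _ w (cong₂ _∧_ (onSpine?-complete on-w) (to T-≡ (fromWitness dw))) unique
    where
    dw : depth w ≡ i
    dw = +-cancelʳ-≡ (D ∸ i) _ _ (trans (cong (depth w +_) (sym tw)) (trans on-w (sym (m+[n∸m]≡n i≤D))))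
    unique : ∀ v → (onSpine? v ∧ ⌊ depth v ≟ℕ i ⌋) ≡ true → v ≡ w
    unique v e with ∧-true⁻ {onSpine? v} e
    ... | on-v , dv = spine-unique _ refl (onSpine?-sound on-v) on-w (trans (toWitness (from T-≡ dv)) (sym dw))

  -- A broom vertex of degree m + 1 has exactly one neighbour on the spine, so m leaves.
  count-leaves : ∀ {z m} (leaf? : Fin n → Bool) → degree G z ≡ suc m →
    (∀ v → indicator (adj G z v) ≡ indicator (leaf? v) + indicator (onSpine? v ∧ adj G z v)) →
    ∀ {w} → OnSpine w → z ∼ w → (∀ {v} → OnSpine v → z ∼ v → v ≡ w) → ∑Fin (indicator ∘ leaf?) ≡ m
  count-leaves {z} {m} leaf? deg split {w} on-w z∼w unique = suc-injective (begin
    suc (∑Fin (indicator ∘ leaf?))                                 ≡⟨ +-comm 1 _ ⟩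
    ∑Fin (indicator ∘ leaf?) + 1                                   ≡⟨ cong (∑Fin (indicator ∘ leaf?) +_) one ⟨
    ∑Fin (indicator ∘ leaf?) + ∑Fin (λ v → indicator (onSpine? v ∧ adj G z v))
                                                                   ≡⟨ sumOver-+ (allFin n) _ _ ⟨
    ∑Fin (λ v → indicator (leaf? v) + indicator (onSpine? v ∧ adj G z v))
                                                                   ≡⟨ sumOver-cong (allFin n) split ⟨
    degree G z                                                     ≡⟨ deg ⟩
    suc m                                                          ∎)
    where
    open ≡-Reasoning
    one : ∑Fin (λ v → indicator (onSpine? v ∧ adj G z v)) ≡ 1
    one = ∑Fin-unique _ w (cong₂ _∧_ (onSpine?-complete on-w) z∼w) λ v e →
      let on-v , z∼v = ∧-true⁻ {onSpine? v} e in unique (onSpine?-sound on-v) z∼v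

  count-xLeaves : ∑Fin (indicator ∘ xLeaf?) ≡ a
  count-xLeaves with zero-or-suc D
  ... | inj₁ D≡0 = ⊥-elim (x≢y (dist≡0⇒≡ D≡0))
  ... | inj₂ (D′ , D≡) with spine-next x-on-spine D≡
  ...   | w , x∼w , _ , dw , on-w = count-leaves xLeaf? deg-x split on-w x∼w unique
    where
    split : ∀ v → indicator (adj G x v) ≡ indicator (xLeaf? v) + indicator (onSpine? v ∧ adj G x v)
    split v with onSpine? v | adj G x v
    ... | true  | true  = refl
    ... | true  | false = refl
    ... | false | true  = refl
    ... | false | false = refl
    unique : ∀ {v} → OnSpine v → x ∼ v → v ≡ w
    unique on-v x∼v = spine-unique _ refl on-v on-w
      (trans (dist-∼ x∼v) (sym (trans dw (cong suc (dist-refl x)))))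

  count-yLeaves : ∑Fin (indicator ∘ yLeaf?) ≡ b
  count-yLeaves with spine-exists 1 (dist-pos x≢y)
  ... | w , on-w , tw = count-leaves yLeaf? deg-y split on-w (∼-sym (dist≡1⇒∼ tw)) unique
    where
    split : ∀ v → indicator (adj G y v) ≡ indicator (yLeaf? v) + indicator (onSpine? v ∧ adj G y v)
    split v with onSpine? v in on? | adj G x v in x∼v | adj G y v in y∼v
    ... | true  | _     | true  = refl
    ... | true  | _     | false = refl
    ... | false | true  | false = refl
    ... | false | false | true  = refl
    ... | false | true  | true  =
      ⊥-elim (x≢y (leaf-neighbour-unique (proj₁ (xLeaf?-sound (cong₂ (λ p q → not p ∧ q) on? x∼v)))
                                         (∼-sym y∼v) (∼-sym x∼v)))
    ... | false | false | false with trans (sym (proj₂ (yLeaf?-sound (cong₂ (λ p q → not p ∧ not q) on? x∼v)))) y∼v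
    ...   | ()
    unique : ∀ {v} → OnSpine v → y ∼ v → v ≡ w
    unique on-v y∼v = spine-unique-toY on-v on-w (trans (dist-∼ (∼-sym y∼v)) (sym tw))

  ∑Where-spine : ∀ {h} (hSpine : ℕ → ℕ) → (∀ {v} → OnSpine v → h v ≡ hSpine (depth v)) →
    ∑Where onSpine? h ≡ sumBelow (suc D) hSpine
  ∑Where-spine {h} hSpine on-spine = begin
    ∑Where onSpine? h
      ≡⟨ sumOver-cong (allFin n) by-depth ⟩
    ∑Fin (λ v → sumBelow (suc D) (λ i → atDepth v i * hSpine i))
      ≡⟨ ∑Fin-sumBelow (suc D) (λ v i → atDepth v i * hSpine i) ⟩
    sumBelow (suc D) (λ i → ∑Fin (λ v → atDepth v i * hSpine i))
      ≡⟨ sumBelow-cong (suc D) (λ i i≤D → trans (∑Where-const (λ v → onSpine? v ∧ ⌊ depth v ≟ℕ i ⌋) (λ _ → refl))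
                                               (trans (cong (hSpine i *_) (spine-at-depth (≤-pred i≤D))) (*-identityʳ _))) ⟩
    sumBelow (suc D) hSpine ∎
    where
    open ≡-Reasoning
    atDepth : Fin n → ℕ → ℕ
    atDepth v i = indicator (onSpine? v ∧ ⌊ depth v ≟ℕ i ⌋)
    by-depth : ∀ v → indicator (onSpine? v) * h v ≡ sumBelow (suc D) (λ i → atDepth v i * hSpine i)
    by-depth v with onSpine? v in on?
    ... | false = sym (sumBelow-zero (suc D))
    ... | true  = trans (+-identityʳ (h v)) (trans (on-spine on) (sym (sumBelow-point (suc D) hSpine depth<1+D)))
      where
      on : OnSpine v
      on = onSpine?-sound on?
      depth<1+D : depth v < suc D
      depth<1+D = s≤s (≤-trans (m≤m+n _ _) (≤-reflexive on))

  ∑Fin-by-class : ∀ (h : Fin n → ℕ) (hSpine : ℕ → ℕ) (hx hy : ℕ) →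
    (∀ {v} → OnSpine v → h v ≡ hSpine (depth v)) → (∀ {v} → XLeaf v → h v ≡ hx) →
    (∀ {v} → YLeaf v → h v ≡ hy) → ∑Fin h ≡ sumBelow (suc D) hSpine + (hx * a + hy * b)
  ∑Fin-by-class h hSpine hx hy on-spine at-x at-y = begin
    ∑Fin h
      ≡⟨ sumOver-cong (allFin n) partition ⟩
    ∑Fin (λ v → indicator (onSpine? v) * h v + (indicator (xLeaf? v) * h v + indicator (yLeaf? v) * h v))
      ≡⟨ trans (sumOver-+ (allFin n) _ _) (cong (∑Where onSpine? h +_) (sumOver-+ (allFin n) _ _)) ⟩
    ∑Where onSpine? h + (∑Where xLeaf? h + ∑Where yLeaf? h)
      ≡⟨ cong₂ _+_ (∑Where-spine hSpine on-spine)
                   (cong₂ _+_ (trans (∑Where-const xLeaf? (at-x ∘ xLeaf?-sound)) (cong (hx *_) count-xLeaves))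
                              (trans (∑Where-const yLeaf? (at-y ∘ yLeaf?-sound)) (cong (hy *_) count-yLeaves))) ⟩
    sumBelow (suc D) hSpine + (hx * a + hy * b) ∎
    where
    open ≡-Reasoning
    partition : ∀ v → h v ≡ indicator (onSpine? v) * h v + (indicator (xLeaf? v) * h v + indicator (yLeaf? v) * h v)
    partition v with onSpine? v | adj G x v
    ... | true  | _     = sym (trans (+-identityʳ _) (+-identityʳ (h v)))
    ... | false | true  = sym (trans (+-identityʳ _) (+-identityʳ (h v)))
    ... | false | false = sym (+-identityʳ (h v))

  spineTransmission : ℕ → ℕ
  spineTransmission = pathBroomTransmission D a b

  transmission-spine : ∀ {u} → OnSpine u → transmission u ≡ spineTransmission (depth u)
  transmission-spine {u} on = trans
    (∑Fin-by-class (d u) (λ j → ∣ depth u - j ∣) (suc (depth u)) (suc (toY u))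
      (spine-dist on) (dist-spine-xLeaf on) (dist-spine-yLeaf on))
    (cong (λ t → sumBelow (suc D) (λ j → ∣ depth u - j ∣) + (suc (depth u) * a + suc t * b)) (toY-on-spine on))

  count-off-spine : ∑Fin (λ v → indicator (not (onSpine? v))) ≡ a + b
  count-off-spine = trans (sumOver-cong (allFin n) split)
    (trans (sumOver-+ (allFin n) _ _) (cong₂ _+_ count-xLeaves count-yLeaves))
    where
    split : ∀ v → indicator (not (onSpine? v)) ≡ indicator (xLeaf? v) + indicator (yLeaf? v)
    split v with onSpine? v | adj G x v
    ... | true  | _     = refl
    ... | false | true  = refl
    ... | false | false = refl

  transmission-sum : ∑Fin transmission + 2 * (a + b)
    ≡ sumBelow (suc D) spineTransmission + ((n + spineTransmission 0) * a + (n + spineTransmission D) * b)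
  transmission-sum = begin
    ∑Fin transmission + 2 * (a + b)
      ≡⟨ cong (∑Fin transmission +_) (trans (sumOver-*ˡ (allFin n) 2 _) (cong (2 *_) count-off-spine)) ⟨
    ∑Fin transmission + ∑Fin (λ v → 2 * indicator (not (onSpine? v)))
      ≡⟨ sumOver-+ (allFin n) _ _ ⟨
    ∑Fin shifted
      ≡⟨ ∑Fin-by-class shifted spineTransmission (n + spineTransmission 0) (n + spineTransmission D) at-spine at-x at-y ⟩
    sumBelow (suc D) spineTransmission + ((n + spineTransmission 0) * a + (n + spineTransmission D) * b) ∎
    where
    open ≡-Reasoning
    shifted : Fin n → ℕ
    shifted v = transmission v + 2 * indicator (not (onSpine? v))
    at-spine : ∀ {v} → OnSpine v → shifted v ≡ spineTransmission (depth v)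
    at-spine on rewrite onSpine?-complete on = trans (+-identityʳ _) (transmission-spine on)
    at-leaf : ∀ {v p} → IsLeaf G v → p ∼ v → OnSpine p → shifted v ≡ n + spineTransmission (depth p)
    at-leaf {v} leaf p∼v on-p with onSpine? v in on?
    ... | true  = ⊥-elim (spine-non-leaf (onSpine?-sound on?) leaf)
    ... | false = trans (transmission-leaf leaf (∼-sym p∼v)) (cong (n +_) (transmission-spine on-p))
    at-x : ∀ {v} → XLeaf v → shifted v ≡ n + spineTransmission 0
    at-x (leaf , x∼v) = trans (at-leaf leaf x∼v x-on-spine) (cong (λ i → n + spineTransmission i) (dist-refl x))
    at-y : ∀ {v} → YLeaf v → shifted v ≡ n + spineTransmission D
    at-y (leaf , y∼v) = at-leaf leaf y∼v y-on-spine

  vertex-count : n ≡ suc D + (a + b)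
  vertex-count = begin
    n
      ≡⟨ ∑Fin-const-1 n ⟨
    ∑Fin {n} (λ _ → 1)
      ≡⟨ ∑Fin-by-class _ (λ _ → 1) 1 1 (λ _ → refl) (λ _ → refl) (λ _ → refl) ⟩
    sumBelow (suc D) (λ _ → 1) + (1 * a + 1 * b)
      ≡⟨ cong₂ _+_ (sumBelow-const-1 (suc D)) (cong₂ _+_ (*-identityˡ a) (*-identityˡ b)) ⟩
    suc D + (a + b) ∎
    where open ≡-Reasoning

doubleBroomBase : ℕ → ℕ → ℕ → ℕ
doubleBroomBase D n g = sumBelow (suc D) (λ i → sumBelow (suc D) (λ j → ∣ i - j ∣))
                      + (sumBelow (suc D) suc * g + ((n + sumBelow (suc D) id) * g + g * g))

doubleBroom-closed-form : ∀ D n a b →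
  sumBelow (suc D) (pathBroomTransmission D a b)
    + ((n + pathBroomTransmission D a b 0) * a + (n + pathBroomTransmission D a b D) * b)
  ≡ doubleBroomBase D n (a + b) + 2 * D * (a * b)
doubleBroom-closed-form D n a b =
  trans (cong₂ _+_ spine-sum (cong₂ (λ s t → (n + s) * a + (n + t) * b) at-x at-y)) (normalise Q S T n a b D)
  where
  Q S T : ℕ
  Q = sumBelow (suc D) (λ i → sumBelow (suc D) (λ j → ∣ i - j ∣))
  S = sumBelow (suc D) suc
  T = sumBelow (suc D) id
  at-x : pathBroomTransmission D a b 0 ≡ T + (1 * a + suc D * b)
  at-x = refl
  at-y : pathBroomTransmission D a b D ≡ T + (suc D * a + 1 * b)
  at-y = cong₂ _+_ (trans (sumBelow-cong (suc D) (λ j j≤D → m≤n⇒∣n-m∣≡n∸m (≤-pred j≤D))) (sumBelow-reverse D id))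
                   (cong (λ k → suc D * a + suc k * b) (n∸n≡0 D))
  spine-sum : sumBelow (suc D) (pathBroomTransmission D a b) ≡ Q + (a * S + b * S)
  spine-sum = trans (sumBelow-+ (suc D) _ _) (cong (Q +_) (trans (sumBelow-+ (suc D) _ _) (cong₂ _+_
    (trans (sumBelow-cong (suc D) (λ i _ → *-comm (suc i) a)) (sumBelow-*ˡ (suc D) a suc))
    (trans (sumBelow-cong (suc D) (λ i _ → *-comm (suc (D ∸ i)) b))
           (trans (sumBelow-*ˡ (suc D) b (λ i → suc (D ∸ i))) (cong (b *_) (sumBelow-reverse D suc)))))))
  normalise : ∀ Q S T n a b D →
    (Q + (a * S + b * S)) + ((n + (T + (1 * a + suc D * b))) * a + (n + (T + (suc D * a + 1 * b))) * b)
    ≡ (Q + (S * (a + b) + ((n + T) * (a + b) + (a + b) * (a + b)))) + 2 * D * (a * b)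
  normalise = solve-∀

*-≤-of-closer : ∀ {a b p q} → a ≤ p → a + b ≡ p + q → p ≤ q → a * b ≤ p * q
*-≤-of-closer {a} {b} {p} {q} a≤p sum≡ p≤q = begin
  a * b             ≡⟨ cong (a *_) b≡t+q ⟩
  a * (t + q)       ≡⟨ *-distribˡ-+ a t q ⟩
  a * t + a * q     ≤⟨ +-monoˡ-≤ (a * q) (*-monoˡ-≤ t (≤-trans a≤p p≤q)) ⟩
  q * t + a * q     ≡⟨ cong (_+ a * q) (*-comm q t) ⟩
  t * q + a * q     ≡⟨ *-distribʳ-+ q t a ⟨
  (t + a) * q       ≡⟨ cong (_* q) (trans (+-comm t a) (m+[n∸m]≡n a≤p)) ⟩
  p * q             ∎
  where
  open ≤-Reasoning
  t : ℕ
  t = p ∸ a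
  b≡t+q : b ≡ t + q
  b≡t+q = +-cancelˡ-≡ a _ _ (trans sum≡ (trans (cong (_+ q) (sym (m+[n∸m]≡n a≤p))) (+-assoc a t q)))

*-≤-balanced : ∀ a b {p q} → a + b ≡ p + q → p ≤ q → q ≤ suc p → a * b ≤ p * q
*-≤-balanced a b {p} {q} sum≡ p≤q q≤1+p with a ≤? p | b ≤? p
... | yes a≤p | _     = *-≤-of-closer a≤p sum≡ p≤q
... | no _    | yes b≤p = subst (_≤ p * q) (*-comm b a) (*-≤-of-closer b≤p (trans (+-comm b a) sum≡) p≤q)
... | no a≰p  | no b≰p  = ⊥-elim (<-irrefl refl (begin-strict
  p + q             ≤⟨ +-monoʳ-≤ p q≤1+p ⟩
  p + suc p         <⟨ +-monoˡ-< (suc p) (≰⇒> a≰p) ⟩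
  a + suc p         ≤⟨ +-monoʳ-≤ a (≰⇒> b≰p) ⟩
  a + b             ≡⟨ sum≡ ⟩
  p + q             ∎))
  where open ≤-Reasoning

halves : ∀ g → g / 2 + (g ∸ g / 2) ≡ g × g / 2 ≤ g ∸ g / 2 × g ∸ g / 2 ≤ suc (g / 2)
halves g = sum≡ , p≤q , q≤1+p
  where
  p q : ℕ
  p = g / 2
  q = g ∸ g / 2
  sum≡ : p + q ≡ g
  sum≡ = m+[n∸m]≡n (m/n≤m g 2)
  p+p≡p*2 : p + p ≡ p * 2
  p+p≡p*2 = trans (cong (p +_) (sym (+-identityʳ p))) (*-comm 2 p)
  p≤q : p ≤ q
  p≤q = +-cancelˡ-≤ p p q (begin
    p + p   ≡⟨ p+p≡p*2 ⟩
    p * 2   ≤⟨ m/n*n≤m g 2 ⟩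
    g       ≡⟨ sum≡ ⟨
    p + q   ∎)
    where open ≤-Reasoning
  q≤1+p : q ≤ suc p
  q≤1+p = +-cancelˡ-≤ p q (suc p) (begin
    p + q           ≡⟨ sum≡ ⟩
    g               ≡⟨ m≡m%n+[m/n]*n g 2 ⟩
    g % 2 + p * 2   ≤⟨ +-mono-≤ (≤-pred (m%n<n g 2)) (≤-reflexive (sym p+p≡p*2)) ⟩
    1 + (p + p)     ≡⟨ +-suc p p ⟨
    p + suc p       ∎)
    where open ≤-Reasoning

*-≤-halves : ∀ a b {g} → a + b ≡ g → a * b ≤ (g / 2) * (g ∸ g / 2)
*-≤-halves a b {g} sum≡ with halves g
... | halves≡ , p≤q , q≤1+p = *-≤-balanced a b (trans sum≡ (sym halves≡)) p≤q q≤1+p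

doubleBroom-wiener : ∀ {n} (G : SimpleGraph n) {a b g} → IsDoubleBroom G a b → a + b ≡ g → 2 ≤ g →
  2 * wiener G + 2 * g ≡ doubleBroomBase (n ∸ suc g) n g + 2 * (n ∸ suc g) * (a * b)
doubleBroom-wiener {n} G {a} {b} ((connected , acyclic) , x , y , x≢y , broom-x , broom-y , brooms , deg-x , deg-y)
  refl 2≤g = begin
  2 * wiener G + 2 * (a + b)
    ≡⟨ cong (_+ 2 * (a + b)) (trans (cong (wiener G +_) (+-identityʳ _)) (wiener-double G connected)) ⟩
  ∑Fin transmission + 2 * (a + b)
    ≡⟨ transmission-sum ⟩
  sumBelow (suc D) (pathBroomTransmission D a b)
    + ((n + pathBroomTransmission D a b 0) * a + (n + pathBroomTransmission D a b D) * b)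
    ≡⟨ doubleBroom-closed-form D n a b ⟩
  doubleBroomBase D n (a + b) + 2 * D * (a * b)
    ≡⟨ cong (λ k → doubleBroomBase k n (a + b) + 2 * k * (a * b)) D≡ ⟩
  doubleBroomBase (n ∸ suc (a + b)) n (a + b) + 2 * (n ∸ suc (a + b)) * (a * b) ∎
  where
  open ≡-Reasoning
  open Distance G using (transmission)
  open Leaves G connected using (broom-degree-pos)
  a≥1 : 1 ≤ a
  a≥1 = broom-degree-pos x≢y broom-x deg-x deg-y 2≤g
  b≥1 : 1 ≤ b
  b≥1 = broom-degree-pos (≢-sym x≢y) broom-y deg-y deg-x (subst (2 ≤_) (+-comm a b) 2≤g)
  open DoubleBroom G connected acyclic x≢y brooms deg-x deg-y a≥1 b≥1
  D≡ : D ≡ n ∸ suc (a + b)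
  D≡ = sym (begin
    n ∸ suc (a + b)               ≡⟨ cong (_∸ suc (a + b)) vertex-count ⟩
    suc D + (a + b) ∸ suc (a + b) ≡⟨ cong (_∸ suc (a + b)) (+-suc D (a + b)) ⟨
    D + suc (a + b) ∸ suc (a + b) ≡⟨ m+n∸n≡m D (suc (a + b)) ⟩
    D                             ∎)

mainTheorem14 : (n a b : ℕ) → 1 ≤ n → 1 ≤ a → 1 ≤ b →
    (a' b' : ℕ) → a' + b' ≡ a + b →
    (G H : SimpleGraph n) →
    IsDoubleBroom G a' b' →
    IsDoubleBroom H ((a + b) / 2) ((a + b) ∸ (a + b) / 2) →
    wiener G ≤ wiener H
mainTheorem14 n a b _ a≥1 b≥1 a' b' a'+b'≡g G H broom-G broom-H =
  *-cancelˡ-≤ 2 (+-cancelʳ-≤ (2 * g) _ _ (begin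
    2 * wiener G + 2 * g             ≡⟨ doubleBroom-wiener G broom-G a'+b'≡g 2≤g ⟩
    base + 2 * D * (a' * b')         ≤⟨ +-monoʳ-≤ base (*-monoʳ-≤ (2 * D) (*-≤-halves a' b' a'+b'≡g)) ⟩
    base + 2 * D * (p * q)           ≡⟨ doubleBroom-wiener H broom-H (proj₁ (halves g)) 2≤g ⟨
    2 * wiener H + 2 * g             ∎))
  where
  open ≤-Reasoning
  g p q D base : ℕ
  g = a + b
  p = g / 2
  q = g ∸ g / 2
  D = n ∸ suc g
  base = doubleBroomBase D n g
  2≤g : 2 ≤ g
  2≤g = +-mono-≤ a≥1 b≥1
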